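{- Let $k\ge4$ and let $\mathsf{X}=\mathsf{L}(k;n,m)$ be the graph with vertices $v_1,\dots,v_k$, exactly one edge between $v_j$ and $v_{j+1}$ for each $1\le j\le k-1$, and one additional edge between $v_n$ and $v_m$, where $2\le n\le k-2$ and $n+2\le m\le k$. With $v_1$ and $v_k$ as the two marked vertices, \[ F_2(\mathsf{X})=(m-n)(k-m+n)+(k-m+n-1)=(k-m+n)(m-n+1)-1. \]
   Context: For a graph with two marked vertices, $F_2$ is the number of spanning forests with exactly two connected components, each containing exactly one marked vertex. -}

module Defs where

open import Data.Nat using (ℕ; zero; suc; _+_; _∸_)
open import Data.Fin using (Fin; zero; suc; inject₁; splitAt)
open import Data.Fin.Subset using (Subset; _∈_)
open import Data.Product using (Σ; ∃; _×_; _,_)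
open import Data.Sum using (_⊎_; inj₁; inj₂)
open import Data.List using (List; []; _∷_; length)
open import Data.List.Relation.Unary.Unique.Propositional using (Unique)
import Data.List.Membership.Propositional as LM
open import Data.Vec using (Vec)
open import Data.Bool using (Bool)
open import Relation.Binary.PropositionalEquality using (_≡_)
open import Relation.Nullary using (¬_)
open import Function.Bundles using (_⇔_)

record Graph (k : ℕ) : Set where
  field
    E    : ℕ
    ends : Fin E → Fin k × Fin k
open Graph public

-- A spanning subgraph is given by the subset of edges it keeps.
EdgeSet : ∀ {k} → Graph k → Set
EdgeSet G = Subset (E G)

Joins : ∀ {k} (G : Graph k) → Fin (E G) → Fin k → Fin k → Set
Joins G e u w = (ends G e ≡ (u , w)) ⊎ (ends G e ≡ (w , u))

data Walk {k} (G : Graph k) (S : EdgeSet G) : Fin k → Fin k → List (Fin (E G)) → Set where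
  nil  : ∀ {u} → Walk G S u u []
  cons : ∀ {u w v e es} → e ∈ S → Joins G e u w → Walk G S w v es → Walk G S u v (e ∷ es)

Connected : ∀ {k} (G : Graph k) → EdgeSet G → Fin k → Fin k → Set
Connected G S u v = ∃ λ es → Walk G S u v es

HasCycle : ∀ {k} (G : Graph k) → EdgeSet G → Set
HasCycle G S = ∃ λ u → ∃ λ e → ∃ λ es → Walk G S u u (e ∷ es) × Unique (e ∷ es)

IsForest : ∀ {k} (G : Graph k) → EdgeSet G → Set
IsForest G S = ¬ HasCycle G S

IsTwoForest : ∀ {k} (G : Graph k) → Fin k → Fin k → EdgeSet G → Set
IsTwoForest G a b S =
  IsForest G S × ¬ Connected G S a b × (∀ w → Connected G S a w ⊎ Connected G S b w)

F₂≡ : ∀ {k} (G : Graph k) → Fin k → Fin k → ℕ → Set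
F₂≡ G a b N = Σ (List (EdgeSet G)) λ Fs →
  Unique Fs × (∀ S → (S LM.∈ Fs) ⇔ IsTwoForest G a b S) × length Fs ≡ N

-- natural number j as a vertex of Fin (suc K) (truncated at K; exact for j ≤ K)
toFin : (K j : ℕ) → Fin (suc K)
toFin K       zero    = zero
toFin zero    (suc j) = zero
toFin (suc K) (suc j) = suc (toFin K j)

-- L(k; n, m) with k = suc K vertices v₁ … v_k, where v_j is  toFin K (j ∸ 1).
-- Edges: index inj₁ i (i : Fin K) is the path edge v_{i+1} — v_{i+2};
-- the last index is the extra edge v_n — v_m.
L : (K n m : ℕ) → Graph (suc K)
L K n m = record { E = K + 1 ; ends = f }
  where
  f : Fin (K + 1) → Fin (suc K) × Fin (suc K)
  f e with splitAt K e
  ... | inj₁ i = inject₁ i , suc i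
  ... | inj₂ _ = toFin K (n ∸ 1) , toFin K (m ∸ 1)

module Submission where

-- L(k; n, m) is the path v₁ — ⋯ — v_k with a chord closing the cycle v_n — ⋯ — v_m. The
-- spanning forests with two trees separating v₁ from v_k are obtained by deleting either the
-- chord and one of the k − 1 path edges, or one of the m − n path edges on the cycle and one of
-- the k − 1 − (m − n) path edges off it; hence F₂ = (k − 1) + (m − n)(k − 1 − m + n).
-- Every graph-theoretic step is certified by a Boolean labelling of the vertices that is
-- constant along all kept edges but possibly one: it shows that edge to be a bridge (no cycle
-- passes through it) or two vertices to be disconnected. Labelling the block of vertices
-- between two deleted path edges shows that a two-forest deletes at most one path edge on the
-- cycle and one off it: otherwise that block would reach neither v₁ nor v_k.

open import Defs
open import Data.Bool using (Bool; true; false; T)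
open import Data.Bool.Properties using (T-≡)
open import Data.Empty using (⊥-elim)
open import Data.Fin using (Fin; zero; suc; toℕ; fromℕ; fromℕ<)
open import Data.Fin.Properties
  using (toℕ<n; toℕ-fromℕ<; toℕ-inject₁; toℕ-injective; splitAt-<; splitAt-≥; +↔⊎; *↔×)
open import Data.Fin.Subset using (_∈_)
open import Data.List using (List; []; _∷_; _++_; [_]; map; allFin)
open import Data.List.Properties using (length-map; length-tabulate)
open import Data.List.Membership.Propositional using () renaming (_∈_ to _∈ₗ_)
open import Data.List.Membership.Propositional.Properties using (∈-map⁺; ∈-map⁻; ∈-allFin)
open import Data.List.Relation.Unary.All as All using (All; []; _∷_)
import Data.List.Relation.Unary.All.Properties as All
open import Data.List.Relation.Unary.AllPairs using ([]; _∷_)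
open import Data.List.Relation.Unary.Any using (here)
open import Data.List.Relation.Unary.Unique.Propositional using (Unique)
import Data.List.Relation.Unary.Unique.Propositional.Properties as Unique
open import Data.Nat
  using (ℕ; zero; suc; _+_; _*_; _∸_; _≤_; _<_; _≤?_; _<?_; _≟_; z≤n; s≤s; z<s; s<s)
open import Data.Nat.Properties
open import Data.Nat.Tactic.RingSolver using (solve-∀)
open import Data.Product using (∃; ∃₂; _×_; _,_; proj₁; proj₂)
open import Data.Product.Function.NonDependent.Propositional using (_×-↔_)
open import Data.Sum using (_⊎_; inj₁; inj₂; [_,_]′)
open import Data.Sum.Function.Propositional using (_⊎-↔_)
open import Data.Unit using (⊤; tt)
open import Data.Vec using (Vec; []; _∷_; lookup; tabulate)
open import Data.Vec.Properties using (lookup⇒[]=; []=⇒lookup)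
open import Function using (_∘_; id)
open import Function.Bundles using (_⇔_; mk⇔; Equivalence; _↔_; Inverse; Injection)
open import Function.Properties.Inverse using (↔-refl; ↔-trans; ↔⇒↣)
open import Relation.Binary.Definitions using (tri<; tri≈; tri>)
open import Relation.Binary.PropositionalEquality
  using (_≡_; _≢_; refl; sym; trans; cong; cong₂; subst; subst₂; ≢-sym; module ≡-Reasoning)
open import Relation.Nullary using (¬_; Dec; does; yes; no; contradiction)
open import Relation.Nullary.Decidable
  using ( ⌊_⌋; dec-true; dec-false; does-⇔; _×-dec_; _⊎-dec_; ¬?; T?
        ; toWitness; fromWitness; decidable-stable)

module _ {k : ℕ} (G : Graph k) where

  Joins-sym : ∀ {e u w} → Joins G e u w → Joins G e w u
  Joins-sym (inj₁ eq) = inj₂ eq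
  Joins-sym (inj₂ eq) = inj₁ eq

module Walks {k : ℕ} (G : Graph k) (S : EdgeSet G) where

  private
    variable
      u v w : Fin k
      e : Fin (E G)
      es fs : List (Fin (E G))

  Walk-++ : Walk G S u w es → Walk G S w v fs → Walk G S u v (es ++ fs)
  Walk-++ nil             q = q
  Walk-++ (cons e∈S j p) q = cons e∈S j (Walk-++ p q)

  Connected-trans : Connected G S u w → Connected G S w v → Connected G S u v
  Connected-trans (_ , p) (_ , q) = _ , Walk-++ p q

  Walk-reverse : Walk G S u v es → Connected G S v u
  Walk-reverse nil             = _ , nil
  Walk-reverse (cons e∈S j p) = Connected-trans (Walk-reverse p) (_ , cons e∈S (Joins-sym G j) nil)

  Connected-sym : Connected G S u v → Connected G S v u
  Connected-sym (_ , p) = Walk-reverse p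

  Respects : {A : Set} → (Fin (E G) → Set) → (Fin k → A) → Set
  Respects P C = ∀ {e} → e ∈ S → P e → C (proj₁ (ends G e)) ≡ C (proj₂ (ends G e))

  Joins-label : {A : Set} (C : Fin k → A) → Joins G e u w →
                C (proj₁ (ends G e)) ≡ C (proj₂ (ends G e)) ⇔ C u ≡ C w
  Joins-label C (inj₁ eq) rewrite eq = mk⇔ id id
  Joins-label C (inj₂ eq) rewrite eq = mk⇔ sym sym

  walk-respects : {A : Set} {P : Fin (E G) → Set} {C : Fin k → A} →
                  Respects P C → Walk G S u v es → All P es → C u ≡ C v
  walk-respects         resp nil             []         = refl
  walk-respects {C = C} resp (cons e∈S j p) (Pe ∷ Pes) =
    trans (Equivalence.to (Joins-label C j) (resp e∈S Pe)) (walk-respects resp p Pes)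

  respects⇒¬Connected : {A : Set} {C : Fin k → A} →
                        Respects (λ _ → ⊤) C → C u ≢ C v → ¬ Connected G S u v
  respects⇒¬Connected resp Cu≢Cv (es , p) =
    Cu≢Cv (walk-respects resp p (All.universal (λ _ → tt) es))

  IsBridge : Fin (E G) → Set
  IsBridge e = ∃ λ (C : Fin k → Bool) →
    Respects (_≢ e) C × C (proj₁ (ends G e)) ≢ C (proj₂ (ends G e))

  -- A cycle through e returns from one end of e to the other without using e.
  bridges⇒IsForest : (∀ {e} → e ∈ S → IsBridge e) → IsForest G S
  bridges⇒IsForest bridge (u , e , es , cons e∈S j p , e∉es ∷ _) with bridge e∈S
  ... | C , resp , C≢ =
    C≢ (Equivalence.from (Joins-label C j) (sym (walk-respects resp p (All.map ≢-sym e∉es))))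

F₂≡-fromEncoding : ∀ {k} {G : Graph k} {x y : Fin k} {N : ℕ} {Code : Set} →
  Fin N ↔ Code →
  (decode : Code → EdgeSet G) → (∀ {c c′} → decode c ≡ decode c′ → c ≡ c′) →
  (∀ S → IsTwoForest G x y S ⇔ ∃ λ c → decode c ≡ S) →
  F₂≡ G x y N
F₂≡-fromEncoding {G = G} {x} {y} {N} enc decode decode-injective twoForest⇔ =
  Fs ,
  Unique.map⁺ (Injection.injective (↔⇒↣ enc) ∘ decode-injective) (Unique.allFin⁺ N) ,
  membership ,
  trans (length-map _ (allFin N)) (length-tabulate id)
  where
  Fs : List (EdgeSet G)
  Fs = map (decode ∘ Inverse.to enc) (allFin N)

  membership : ∀ S → (S ∈ₗ Fs) ⇔ IsTwoForest G x y S
  membership S = mk⇔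
    (λ S∈Fs → let (i , _ , S≡) = ∈-map⁻ _ S∈Fs in
      Equivalence.from (twoForest⇔ S) (Inverse.to enc i , sym S≡))
    (λ twoForest → let (c , c↦S) = Equivalence.to (twoForest⇔ S) twoForest in
      subst (_∈ₗ Fs) (trans (cong decode (Inverse.strictlyInverseˡ enc c)) c↦S)
            (∈-map⁺ _ (∈-allFin (Inverse.from enc c))))

private
  variable
    n : ℕ

at : Vec Bool n → ℕ → Bool
at []      _       = false
at (x ∷ v) zero    = x
at (x ∷ v) (suc t) = at v t

infix 4 _∋_
_∋_ : Vec Bool n → ℕ → Set
v ∋ t = T (at v t)

at-lookup : (v : Vec Bool n) (i : Fin n) → at v (toℕ i) ≡ lookup v i
at-lookup (x ∷ v) zero    = refl
at-lookup (x ∷ v) (suc i) = at-lookup v i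

∈⇒∋ : ∀ {p : Vec Bool n} {i} → i ∈ p → p ∋ toℕ i
∈⇒∋ {p = p} {i} i∈p rewrite at-lookup p i | []=⇒lookup i∈p = tt

∋⇒∈ : ∀ {p : Vec Bool n} {i} → p ∋ toℕ i → i ∈ p
∋⇒∈ {p = p} {i} p∋i = lookup⇒[]= i p (trans (sym (at-lookup p i)) (Equivalence.to T-≡ p∋i))

at-tabulate : (f : ℕ → Bool) {t : ℕ} → t < n → at (tabulate {n = n} (f ∘ toℕ)) t ≡ f t
at-tabulate {suc n} f {zero}  _         = refl
at-tabulate {suc n} f {suc t} (s≤s t<n) = at-tabulate (f ∘ suc) t<n

T-injective : ∀ {x y} → (T x ⇔ T y) → x ≡ y
T-injective {false} {false} _   = refl
T-injective {false} {true}  x⇔y = ⊥-elim (Equivalence.from x⇔y tt)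
T-injective {true}  {false} x⇔y = ⊥-elim (Equivalence.to x⇔y tt)
T-injective {true}  {true}  _   = refl

∋-ext : {v w : Vec Bool n} → (∀ {t} → t < n → v ∋ t ⇔ w ∋ t) → v ≡ w
∋-ext {v = []}    {[]}    _   = refl
∋-ext {v = x ∷ v} {y ∷ w} v⇔w = cong₂ _∷_ (T-injective (v⇔w z<s)) (∋-ext (v⇔w ∘ s<s))

avoids? : (r s t : ℕ) → Dec (t ≢ r × t ≢ s)
avoids? r s t = ¬? (t ≟ r) ×-dec ¬? (t ≟ s)

omit : ℕ → ℕ → Vec Bool n
omit r s = tabulate (⌊_⌋ ∘ avoids? r s ∘ toℕ)

module _ {r s : ℕ} where

  omit-∋ : ∀ {t} → t < n → omit {n} r s ∋ t ⇔ (t ≢ r × t ≢ s)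
  omit-∋ {t = t} t<n rewrite at-tabulate (⌊_⌋ ∘ avoids? r s) t<n =
    mk⇔ (toWitness {a? = avoids? r s t}) (fromWitness {a? = avoids? r s t})

  omit-∌ : ∀ {t} → t < n → ¬ omit {n} r s ∋ t → t ≡ r ⊎ t ≡ s
  omit-∌ {t = t} t<n t∉ with t ≟ r | t ≟ s
  ... | yes t≡r | _       = inj₁ t≡r
  ... | no _    | yes t≡s = inj₂ t≡s
  ... | no t≢r  | no t≢s  = contradiction (Equivalence.from (omit-∋ t<n) (t≢r , t≢s)) t∉

  omit-∌ˡ : r < n → ¬ omit {n} r s ∋ r
  omit-∌ˡ r<n r∈ = proj₁ (Equivalence.to (omit-∋ r<n) r∈) refl

  omit-∌ʳ : s < n → ¬ omit {n} r s ∋ s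
  omit-∌ʳ s<n s∈ = proj₂ (Equivalence.to (omit-∋ s<n) s∈) refl


omit-injective : ∀ {r s r′ s′} → r < n → s < n → r ≢ s′ → s ≢ r′ →
                 omit {n} r s ≡ omit r′ s′ → r ≡ r′ × s ≡ s′
omit-injective {r = r} {s} r<n s<n r≢s′ s≢r′ eq =
  [ id , ⊥-elim ∘ r≢s′ ]′ (omit-∌ r<n (subst (λ v → ¬ v ∋ r) eq (omit-∌ˡ r<n))) ,
  [ ⊥-elim ∘ s≢r′ , id ]′ (omit-∌ s<n (subst (λ v → ¬ v ∋ s) eq (omit-∌ʳ s<n)))

Between Outside : ℕ → ℕ → ℕ → Set
Between p q i = p ≤ i × i < q
Outside p q i = i < p ⊎ q ≤ i

Between⇒≢Outside : ∀ {p q i j} → Between p q i → Outside p q j → i ≢ j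
Between⇒≢Outside (p≤i , _)   (inj₁ j<p) refl = <⇒≱ j<p p≤i
Between⇒≢Outside (_   , i<q) (inj₂ q≤j) refl = <⇒≱ i<q q≤j

Outside-shrink : ∀ {p q x r} → x ≤ q → Outside p q r → Outside p x r
Outside-shrink _   (inj₁ r<p) = inj₁ r<p
Outside-shrink x≤q (inj₂ q≤r) = inj₂ (≤-trans x≤q q≤r)

block? : (p q v : ℕ) → Dec (p ≤ v × v ≤ q)
block? p q v = p ≤? v ×-dec v ≤? q

inBlock : ℕ → ℕ → ℕ → Bool
inBlock p q v = does (block? p q v)

module _ (p q : ℕ) where

  inBlock-inside : ∀ {v} → p ≤ v → v ≤ q → inBlock p q v ≡ true
  inBlock-inside p≤v v≤q = dec-true (block? p q _) (p≤v , v≤q)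

  inBlock-outside : ∀ {v} → v < p ⊎ q < v → inBlock p q v ≡ false
  inBlock-outside {v} (inj₁ v<p) = dec-false (block? p q v) λ (p≤v , _) → <⇒≱ v<p p≤v
  inBlock-outside {v} (inj₂ q<v) = dec-false (block? p q v) λ (_ , v≤q) → <⇒≱ q<v v≤q

  inBlock-inside₂ : ∀ {x y} → p ≤ x → x ≤ q → p ≤ y → y ≤ q →
                    inBlock p q x ≡ inBlock p q y
  inBlock-inside₂ p≤x x≤q p≤y y≤q =
    trans (inBlock-inside p≤x x≤q) (sym (inBlock-inside p≤y y≤q))

  inBlock-outside₂ : ∀ {x y} → x < p ⊎ q < x → y < p ⊎ q < y →
                     inBlock p q x ≡ inBlock p q y
  inBlock-outside₂ x-out y-out = trans (inBlock-outside x-out) (sym (inBlock-outside y-out))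

  inBlock-separates : ∀ {x y} → p ≤ x → x ≤ q → y < p ⊎ q < y →
                      inBlock p q x ≢ inBlock p q y
  inBlock-separates p≤x x≤q y-out eq
    with () ← trans (sym (inBlock-inside p≤x x≤q)) (trans eq (inBlock-outside y-out))

  inBlock-step : ∀ {i} → i ≢ q → suc i ≢ p → inBlock p q i ≡ inBlock p q (suc i)
  inBlock-step {i} i≢q 1+i≢p = does-⇔
    (mk⇔ (λ (p≤i , i≤q) → m≤n⇒m≤1+n p≤i , ≤∧≢⇒< i≤q i≢q)
         (λ (p≤1+i , 1+i≤q) → m<1+n⇒m≤n (≤∧≢⇒< p≤1+i (≢-sym 1+i≢p)) , <⇒≤ 1+i≤q))
    (block? p q i) (block? p q (suc i))

toFin-toℕ : ∀ K (w : Fin (suc K)) → toFin K (toℕ w) ≡ w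
toFin-toℕ K       zero    = refl
toFin-toℕ (suc K) (suc w) = cong suc (toFin-toℕ K w)

toℕ-toFin : ∀ {K t} → t ≤ K → toℕ (toFin K t) ≡ t
toℕ-toFin {K}     {zero}  _         = refl
toℕ-toFin {suc K} {suc t} (s≤s t≤K) = cong suc (toℕ-toFin t≤K)

toFin-self : ∀ K → toFin K K ≡ fromℕ K
toFin-self zero    = refl
toFin-self (suc K) = cong suc (toFin-self K)

-- L(k; n, m) with n = a + 1, m = b + 1 and k = K + 1. Vertex v_{t+1} is V t; the edge at position
-- t < K joins V t and V (t + 1), and position K is the chord joining V a and V b.
module PathWithChord (a d e : ℕ) (0<d : 0 < d) where

  b K : ℕ
  b = a + d
  K = b + e

  a<b : a < b
  a<b = m<m+n a 0<d

  b≤K : b ≤ K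
  b≤K = m≤m+n b e

  a≤K : a ≤ K
  a≤K = ≤-trans (<⇒≤ a<b) b≤K

  G : Graph (suc K)
  G = L K (suc a) (suc b)

  V : ℕ → Fin (suc K)
  V = toFin K

  InCycle OffCycle : ℕ → Set
  InCycle  = Between a b
  OffCycle = Outside a b

  private
    variable
      i j p q r s t x y : ℕ

  ≤K⇒<K+1 : t ≤ K → t < K + 1
  ≤K⇒<K+1 {t} t≤K = subst (t <_) (+-comm 1 K) (s≤s t≤K)

  <K+1⇒≤K : t < K + 1 → t ≤ K
  <K+1⇒≤K {t} t<K+1 = m<1+n⇒m≤n (subst (t <_) (+-comm K 1) t<K+1)

  ≡V : ∀ {w} → toℕ w ≡ t → w ≡ V t
  ≡V {w = w} refl = sym (toFin-toℕ K w)

  ends-path : (f : Fin (E G)) → toℕ f < K → ends G f ≡ (V (toℕ f) , V (suc (toℕ f)))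
  ends-path f f<K rewrite splitAt-< K f f<K =
    cong₂ _,_ (≡V (trans (toℕ-inject₁ _) (toℕ-fromℕ< f<K)))
              (≡V (cong suc (toℕ-fromℕ< f<K)))

  ends-chord : (f : Fin (E G)) → K ≤ toℕ f → ends G f ≡ (V a , V b)
  ends-chord f K≤f rewrite splitAt-≥ K f K≤f = refl

  ends-toℕ : (f : Fin (E G)) →
    (toℕ f < K × toℕ (proj₁ (ends G f)) ≡ toℕ f × toℕ (proj₂ (ends G f)) ≡ suc (toℕ f))
    ⊎ (toℕ f ≡ K × toℕ (proj₁ (ends G f)) ≡ a × toℕ (proj₂ (ends G f)) ≡ b)
  ends-toℕ f with toℕ f <? K
  ... | yes f<K rewrite ends-path f f<K = inj₁ (f<K , toℕ-toFin (<⇒≤ f<K) , toℕ-toFin f<K)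
  ... | no f≮K rewrite ends-chord f (≮⇒≥ f≮K) =
    inj₂ (≤-antisym (<K+1⇒≤K (toℕ<n f)) (≮⇒≥ f≮K) , toℕ-toFin a≤K , toℕ-toFin b≤K)

  edge : (t : ℕ) → t ≤ K → Fin (E G)
  edge t t≤K = fromℕ< (≤K⇒<K+1 t≤K)

  toℕ-edge : (t≤K : t ≤ K) → toℕ (edge t t≤K) ≡ t
  toℕ-edge t≤K = toℕ-fromℕ< (≤K⇒<K+1 t≤K)

  path-Joins : (t<K : t < K) → Joins G (edge t (<⇒≤ t<K)) (V t) (V (suc t))
  path-Joins {t} t<K =
    inj₁ (subst (λ u → ends G (edge t t≤K) ≡ (V u , V (suc u))) (toℕ-edge t≤K)
                (ends-path _ (subst (_< K) (sym (toℕ-edge t≤K)) t<K)))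
    where
    t≤K : t ≤ K
    t≤K = <⇒≤ t<K

  chord-Joins : Joins G (edge K ≤-refl) (V a) (V b)
  chord-Joins = inj₁ (ends-chord _ (≤-reflexive (sym (toℕ-edge ≤-refl))))

  OffCycle? : ∀ i → Dec (OffCycle i)
  OffCycle? i = (i <? a) ⊎-dec (b ≤? i)

  cycle-position : ∀ i → InCycle i ⊎ OffCycle i
  cycle-position i with a ≤? i | i <? b
  ... | yes a≤i | yes i<b = inj₁ (a≤i , i<b)
  ... | no a≰i  | _       = inj₂ (inj₁ (≰⇒> a≰i))
  ... | yes _   | no i≮b  = inj₂ (inj₂ (≮⇒≥ i≮b))

  OffCycle⇒chord-invariant : OffCycle p → inBlock 0 p a ≡ inBlock 0 p b
  OffCycle⇒chord-invariant {p} (inj₁ p<a) =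
    inBlock-outside₂ 0 p (inj₂ p<a) (inj₂ (<-trans p<a a<b))
  OffCycle⇒chord-invariant {p} (inj₂ b≤p) =
    inBlock-inside₂ 0 p z≤n (≤-trans (<⇒≤ a<b) b≤p) z≤n b≤p

  SameSide : ℕ → ℕ → Set
  SameSide i j = (InCycle i × InCycle j) ⊎ (OffCycle i × OffCycle j)

  SameSide-sym : SameSide i j → SameSide j i
  SameSide-sym (inj₁ (i-in , j-in))   = inj₁ (j-in , i-in)
  SameSide-sym (inj₂ (i-off , j-off)) = inj₂ (j-off , i-off)

  SameSide⇒chord-invariant : i < j → SameSide i j →
                             inBlock (suc i) j a ≡ inBlock (suc i) j b
  SameSide⇒chord-invariant {i} {j} _ (inj₁ ((a≤i , _) , (_ , j<b))) =
    inBlock-outside₂ (suc i) j (inj₁ (s≤s a≤i)) (inj₂ j<b)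
  SameSide⇒chord-invariant {i} {j} _ (inj₂ (inj₁ i<a , inj₁ j<a)) =
    inBlock-outside₂ (suc i) j (inj₂ j<a) (inj₂ (<-trans j<a a<b))
  SameSide⇒chord-invariant {i} {j} _ (inj₂ (inj₁ i<a , inj₂ b≤j)) =
    inBlock-inside₂ (suc i) j i<a (≤-trans (<⇒≤ a<b) b≤j) (<-trans i<a a<b) b≤j
  SameSide⇒chord-invariant {i} {j} _ (inj₂ (inj₂ b≤i , _)) =
    inBlock-outside₂ (suc i) j (inj₁ (s≤s (≤-trans (<⇒≤ a<b) b≤i))) (inj₁ (s≤s b≤i))

  module _ (S : EdgeSet G) where

    open Walks G S

    present≢absent : S ∋ i → ¬ S ∋ j → i ≢ j
    present≢absent i∈S j∉S refl = j∉S i∈S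

    ∋-stable : ¬ ¬ S ∋ t → S ∋ t
    ∋-stable {t} = decidable-stable (T? (at S t))

    Invariant : (ℕ → Set) → (ℕ → Bool) → Set
    Invariant P C = (∀ {i} → i < K → S ∋ i → P i → C i ≡ C (suc i))
                  × (S ∋ K → P K → C a ≡ C b)

    Invariant⇒Respects : ∀ {P C} → Invariant P C → Respects (P ∘ toℕ) (C ∘ toℕ)
    Invariant⇒Respects {P} (along-path , along-chord) {f} f∈S Pf with ends-toℕ f
    ... | inj₁ (f<K , ≡x , ≡y) rewrite ≡x | ≡y = along-path f<K (∈⇒∋ f∈S) Pf
    ... | inj₂ (f≡K , ≡x , ≡y) rewrite ≡x | ≡y =
      along-chord (subst (S ∋_) f≡K (∈⇒∋ f∈S)) (subst P f≡K Pf)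

    Invariant⇒¬Connected : ∀ {C} → Invariant (λ _ → ⊤) C →
                           x ≤ K → y ≤ K → C x ≢ C y → ¬ Connected G S (V x) (V y)
    Invariant⇒¬Connected {C = C} inv x≤K y≤K Cx≢Cy =
      respects⇒¬Connected {C = C ∘ toℕ} (Invariant⇒Respects inv)
        (subst₂ (λ x y → C x ≢ C y) (sym (toℕ-toFin x≤K)) (sym (toℕ-toFin y≤K)) Cx≢Cy)

    path-bridges⇒IsForest :
      (∀ {j} → j < K → S ∋ j → ∃ λ C → Invariant (_≢ j) C × C j ≢ C (suc j)) →
      (S ∋ K → ∃ λ C → Invariant (_≢ K) C × C a ≢ C b) → IsForest G S
    path-bridges⇒IsForest path-bridge chord-bridge = bridges⇒IsForest bridge
      where
      bridge : ∀ {f} → f ∈ S → IsBridge f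
      bridge {f} f∈S with ends-toℕ f
      ... | inj₁ (f<K , ≡x , ≡y) =
        let (C , inv , C≢) = path-bridge f<K (∈⇒∋ f∈S)
        in C ∘ toℕ ,
           (λ f′∈S f′≢f → Invariant⇒Respects inv f′∈S (f′≢f ∘ toℕ-injective)) ,
           subst₂ (λ x y → C x ≢ C y) (sym ≡x) (sym ≡y) C≢
      ... | inj₂ (f≡K , ≡x , ≡y) =
        let (C , inv , C≢) = chord-bridge (subst (S ∋_) f≡K (∈⇒∋ f∈S))
        in C ∘ toℕ ,
           (λ f′∈S f′≢f → Invariant⇒Respects inv f′∈S λ f′≡K →
             f′≢f (toℕ-injective (trans f′≡K (sym f≡K)))) ,
           subst₂ (λ x y → C x ≢ C y) (sym ≡x) (sym ≡y) C≢

    path-Walk : p ≤ q → q ≤ K → (∀ {i} → p ≤ i → i < q → S ∋ i) →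
                ∃ λ es → Walk G S (V p) (V q) es × Unique es × All (λ f → toℕ f < q) es
    path-Walk {q = zero}  z≤n _ _ = [] , nil , [] , []
    path-Walk {q = suc q} p≤1+q 1+q≤K present with m≤n⇒m<n∨m≡n p≤1+q
    ... | inj₂ refl = [] , nil , [] , []
    ... | inj₁ (s≤s p≤q)
      with es , walk , unique , es<q ←
             path-Walk p≤q (<⇒≤ 1+q≤K) (λ p≤i i<q → present p≤i (m≤n⇒m≤1+n i<q)) =
      es ++ [ last ] ,
      Walk-++ walk (cons last∈S (path-Joins 1+q≤K) nil) ,
      Unique.++⁺ unique ([] ∷ [])
        (λ (f∈es , f∈[last]) → <-irrefl (toℕ-last f∈[last]) (All.lookup es<q f∈es)) ,
      All.++⁺ (All.map m≤n⇒m≤1+n es<q) (subst (_< suc q) (sym (toℕ-edge q≤K)) ≤-refl ∷ [])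
      where
      q≤K : q ≤ K
      q≤K = <⇒≤ 1+q≤K
      last : Fin (E G)
      last = edge q q≤K
      last∈S : last ∈ S
      last∈S = ∋⇒∈ (subst (S ∋_) (sym (toℕ-edge q≤K)) (present p≤q ≤-refl))
      toℕ-last : ∀ {f} → f ∈ₗ [ last ] → toℕ f ≡ q
      toℕ-last (here refl) = toℕ-edge q≤K

    path-connected : p ≤ q → q ≤ K → (∀ {i} → p ≤ i → i < q → S ∋ i) →
                     Connected G S (V p) (V q)
    path-connected p≤q q≤K present =
      let (es , walk , _) = path-Walk p≤q q≤K present in es , walk

    chord∈ : S ∋ K → edge K ≤-refl ∈ S
    chord∈ K∈S = ∋⇒∈ (subst (S ∋_) (sym (toℕ-edge ≤-refl)) K∈S)

    chord-connected : S ∋ K → Connected G S (V a) (V b)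
    chord-connected K∈S = _ , cons (chord∈ K∈S) chord-Joins nil

    closed-cycle : S ∋ K → (∀ {i} → InCycle i → S ∋ i) → HasCycle G S
    closed-cycle K∈S present
      with es , walk , unique , es<b ←
             path-Walk (<⇒≤ a<b) b≤K (λ a≤i i<b → present (a≤i , i<b)) =
      V b , edge K ≤-refl , es , cons (chord∈ K∈S) (Joins-sym G chord-Joins) walk ,
      All.map (λ f<b chord≡f → <⇒≱ f<b (subst (b ≤_) (toℕ-chord chord≡f) b≤K)) es<b
        ∷ unique
      where
      toℕ-chord : ∀ {f} → edge K ≤-refl ≡ f → K ≡ toℕ f
      toℕ-chord refl = sym (toℕ-edge ≤-refl)

    -- A path edge j off the cycle is a bridge via the block [0, j], one on the cycle via the
    -- vertices between the edges j and r, and the chord via the block [0, r].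
    missing-cycle-edge⇒IsForest : InCycle r ⊎ r ≡ K → ¬ S ∋ r → IsForest G S
    missing-cycle-edge⇒IsForest {r} r-on-cycle r∉S =
      path-bridges⇒IsForest path-bridge chord-bridge
      where
      chord⇒InCycle : S ∋ K → InCycle r
      chord⇒InCycle K∈S =
        [ id , (λ r≡K → ⊥-elim (r∉S (subst (S ∋_) (sym r≡K) K∈S))) ]′ r-on-cycle

      path-bridge : j < K → S ∋ j → ∃ λ C → Invariant (_≢ j) C × C j ≢ C (suc j)
      path-bridge {j} _ j∈S with cycle-position j
      ... | inj₂ j-off =
        inBlock 0 j , (along-path , λ _ _ → OffCycle⇒chord-invariant j-off) ,
        inBlock-separates 0 j z≤n ≤-refl (inj₂ ≤-refl)
        where
        along-path : i < K → S ∋ i → i ≢ j → inBlock 0 j i ≡ inBlock 0 j (suc i)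
        along-path _ _ i≢j = inBlock-step 0 j i≢j (λ ())
      ... | inj₁ (a≤j , j<b) with <-cmp j r
      ...   | tri≈ _ j≡r _ = ⊥-elim (present≢absent j∈S r∉S j≡r)
      ...   | tri< j<r _ _ =
        inBlock (suc j) r , (along-path , along-chord) ,
        ≢-sym (inBlock-separates (suc j) r ≤-refl j<r (inj₁ ≤-refl))
        where
        along-path : i < K → S ∋ i → i ≢ j → inBlock (suc j) r i ≡ inBlock (suc j) r (suc i)
        along-path _ i∈S i≢j =
          inBlock-step (suc j) r (present≢absent i∈S r∉S) (i≢j ∘ suc-injective)
        along-chord : S ∋ K → K ≢ j → inBlock (suc j) r a ≡ inBlock (suc j) r b
        along-chord K∈S _ =
          inBlock-outside₂ (suc j) r (inj₁ (s≤s a≤j)) (inj₂ (proj₂ (chord⇒InCycle K∈S)))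
      ...   | tri> _ _ r<j =
        inBlock (suc r) j , (along-path , along-chord) ,
        inBlock-separates (suc r) j r<j ≤-refl (inj₂ ≤-refl)
        where
        along-path : i < K → S ∋ i → i ≢ j → inBlock (suc r) j i ≡ inBlock (suc r) j (suc i)
        along-path _ i∈S i≢j =
          inBlock-step (suc r) j i≢j (present≢absent i∈S r∉S ∘ suc-injective)
        along-chord : S ∋ K → K ≢ j → inBlock (suc r) j a ≡ inBlock (suc r) j b
        along-chord K∈S _ =
          inBlock-outside₂ (suc r) j (inj₁ (s≤s (proj₁ (chord⇒InCycle K∈S)))) (inj₂ j<b)

      chord-bridge : S ∋ K → ∃ λ C → Invariant (_≢ K) C × C a ≢ C b
      chord-bridge K∈S =
        inBlock 0 r , (along-path , λ _ K≢K → ⊥-elim (K≢K refl)) ,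
        inBlock-separates 0 r z≤n a≤r (inj₂ r<b)
        where
        a≤r : a ≤ r
        a≤r = proj₁ (chord⇒InCycle K∈S)
        r<b : r < b
        r<b = proj₂ (chord⇒InCycle K∈S)
        along-path : i < K → S ∋ i → i ≢ K → inBlock 0 r i ≡ inBlock 0 r (suc i)
        along-path _ i∈S _ = inBlock-step 0 r (present≢absent i∈S r∉S) (λ ())

    cut⇒¬Connected : p < K → ¬ S ∋ p → (S ∋ K → OffCycle p) →
                     ¬ Connected G S (V 0) (V K)
    cut⇒¬Connected {p} p<K p∉S chord⇒OffCycle =
      Invariant⇒¬Connected
        (along-path , λ K∈S _ → OffCycle⇒chord-invariant (chord⇒OffCycle K∈S))
        z≤n ≤-refl (inBlock-separates 0 p z≤n z≤n (inj₂ p<K))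
      where
      along-path : i < K → S ∋ i → ⊤ → inBlock 0 p i ≡ inBlock 0 p (suc i)
      along-path _ i∈S _ = inBlock-step 0 p (present≢absent i∈S p∉S) (λ ())

    two-cuts⇒isolated : i < j → j < K → ¬ S ∋ i → ¬ S ∋ j → (S ∋ K → SameSide i j) →
                        ¬ Connected G S (V 0) (V j) × ¬ Connected G S (V K) (V j)
    two-cuts⇒isolated {i} {j} i<j j<K i∉S j∉S chord⇒SameSide =
      isolated z≤n (inj₁ z<s) , isolated ≤-refl (inj₂ j<K)
      where
      along-path : t < K → S ∋ t → ⊤ → inBlock (suc i) j t ≡ inBlock (suc i) j (suc t)
      along-path _ t∈S _ = inBlock-step (suc i) j
        (present≢absent t∈S j∉S) (present≢absent t∈S i∉S ∘ suc-injective)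
      isolated : x ≤ K → x < suc i ⊎ j < x → ¬ Connected G S (V x) (V j)
      isolated x≤K x-out = Invariant⇒¬Connected
        (along-path , λ K∈S _ → SameSide⇒chord-invariant i<j (chord⇒SameSide K∈S))
        x≤K (<⇒≤ j<K) (≢-sym (inBlock-separates (suc i) j i<j ≤-refl x-out))

    TwoForest : Set
    TwoForest = IsForest G S × ¬ Connected G S (V 0) (V K) ×
                (∀ {t} → t ≤ K → Connected G S (V 0) (V t) ⊎ Connected G S (V K) (V t))

    IsTwoForest⇔TwoForest : IsTwoForest G zero (fromℕ K) S ⇔ TwoForest
    IsTwoForest⇔TwoForest rewrite sym (toFin-self K) = mk⇔
      (λ (forest , apart , cover) → forest , apart , λ {t} _ → cover (V t))
      (λ (forest , apart , cover) → forest , apart , λ w →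
        subst (λ w → Connected G S (V 0) w ⊎ Connected G S (V K) w) (toFin-toℕ K w)
              (cover (m<1+n⇒m≤n (toℕ<n w))))

    absent-unique : TwoForest → i < K → j < K → ¬ S ∋ i → ¬ S ∋ j →
                    (S ∋ K → SameSide i j) → i ≡ j
    absent-unique {i} {j} (_ , _ , cover) i<K j<K i∉S j∉S same with <-cmp i j
    ... | tri≈ _ i≡j _ = i≡j
    ... | tri< i<j _ _ = ⊥-elim ([ proj₁ isolated , proj₂ isolated ]′ (cover (<⇒≤ j<K)))
      where
      isolated : ¬ Connected G S (V 0) (V j) × ¬ Connected G S (V K) (V j)
      isolated = two-cuts⇒isolated i<j j<K i∉S j∉S same
    ... | tri> _ _ j<i = ⊥-elim ([ proj₁ isolated , proj₂ isolated ]′ (cover (<⇒≤ i<K)))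
      where
      isolated : ¬ Connected G S (V 0) (V i) × ¬ Connected G S (V K) (V i)
      isolated = two-cuts⇒isolated j<i i<K j∉S i∉S (SameSide-sym ∘ same)

    ≡omit : ¬ S ∋ r → ¬ S ∋ s → (∀ {t} → t ≤ K → t ≢ r → t ≢ s → S ∋ t) →
            S ≡ omit r s
    ≡omit r∉S s∉S others = ∋-ext λ t<K+1 → mk⇔
      (λ t∈S → Equivalence.from (omit-∋ t<K+1)
                 (present≢absent t∈S r∉S , present≢absent t∈S s∉S))
      (λ t∈omit → let (t≢r , t≢s) = Equivalence.to (omit-∋ t<K+1) t∈omit in
        others (<K+1⇒≤K t<K+1) t≢r t≢s)

    absent? : ∀ i → Dec (¬ S ∋ i)
    absent? i = ¬? (T? (at S i))

    TwoForest-without-chord : TwoForest → ¬ S ∋ K → ∃ λ r → r < K × S ≡ omit r K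
    TwoForest-without-chord tf@(_ , apart , _) K∉S with anyUpTo? absent? K
    ... | no ∄r =
      ⊥-elim (apart (path-connected z≤n ≤-refl λ _ i<K →
                       ∋-stable λ i∉S → ∄r (_ , i<K , i∉S)))
    ... | yes (r , r<K , r∉S) = r , r<K , ≡omit r∉S K∉S present
      where
      present : t ≤ K → t ≢ r → t ≢ K → S ∋ t
      present t≤K t≢r t≢K = ∋-stable λ t∉S →
        t≢r (absent-unique tf (≤∧≢⇒< t≤K t≢K) r<K t∉S r∉S (⊥-elim ∘ K∉S))

    TwoForest-with-chord : TwoForest → S ∋ K →
                           ∃₂ λ r s → InCycle r × OffCycle s × s < K × S ≡ omit r s
    TwoForest-with-chord tf@(forest , apart , _) K∈S
      with anyUpTo? (λ i → absent? i ×-dec a ≤? i) b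
         | anyUpTo? (λ i → absent? i ×-dec OffCycle? i) K
    ... | no ∄r | _ = ⊥-elim (forest (closed-cycle K∈S λ (a≤i , i<b) →
                                        ∋-stable λ i∉S → ∄r (_ , i<b , i∉S , a≤i)))
    ... | _ | no ∄s = ⊥-elim (apart (Connected-trans (path-connected z≤n a≤K below-cycle)
                                    (Connected-trans (chord-connected K∈S)
                                                     (path-connected b≤K ≤-refl beyond-cycle))))
      where
      below-cycle : 0 ≤ i → i < a → S ∋ i
      below-cycle _ i<a = ∋-stable λ i∉S → ∄s (_ , <-≤-trans i<a a≤K , i∉S , inj₁ i<a)
      beyond-cycle : b ≤ i → i < K → S ∋ i
      beyond-cycle b≤i i<K = ∋-stable λ i∉S → ∄s (_ , i<K , i∉S , inj₂ b≤i)
    ... | yes (r , r<b , r∉S , a≤r) | yes (s , s<K , s∉S , s-off) =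
      r , s , r-in , s-off , s<K , ≡omit r∉S s∉S present
      where
      r-in : InCycle r
      r-in = a≤r , r<b
      r<K : r < K
      r<K = <-≤-trans r<b b≤K
      present : t ≤ K → t ≢ r → t ≢ s → S ∋ t
      present {t} t≤K t≢r t≢s with t ≟ K
      ... | yes refl = K∈S
      ... | no t≢K = ∋-stable λ t∉S →
        [ (λ t-in  → t≢r (absent-unique tf t<K r<K t∉S r∉S λ _ → inj₁ (t-in , r-in)))
        , (λ t-off → t≢s (absent-unique tf t<K s<K t∉S s∉S λ _ → inj₂ (t-off , s-off)))
        ]′ (cycle-position t)
        where
        t<K : t < K
        t<K = ≤∧≢⇒< t≤K t≢K

  omit-segment : x ≤ K → Outside p x r → Outside p x s → p ≤ x →
                 Connected G (omit r s) (V p) (V x)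
  omit-segment x≤K r-out s-out p≤x = path-connected _ p≤x x≤K λ p≤i i<x →
    Equivalence.from (omit-∋ (≤K⇒<K+1 (<⇒≤ (<-≤-trans i<x x≤K))))
      (Between⇒≢Outside (p≤i , i<x) r-out , Between⇒≢Outside (p≤i , i<x) s-out)

  omit-block : q ≤ K → Outside p q r → Outside p q s → p ≤ x × x ≤ q → p ≤ y × y ≤ q →
               Connected G (omit r s) (V x) (V y)
  omit-block {q = q} {p} {r} {s} q≤K r-out s-out (p≤x , x≤q) (p≤y , y≤q) =
    Connected-trans (Connected-sym (segment x≤q p≤x)) (segment y≤q p≤y)
    where
    open Walks G (omit r s)
    segment : x ≤ q → p ≤ x → Connected G (omit r s) (V p) (V x)
    segment x≤q =
      omit-segment (≤-trans x≤q q≤K) (Outside-shrink x≤q r-out) (Outside-shrink x≤q s-out)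

  omit-chord-TwoForest : r < K → TwoForest (omit r K)
  omit-chord-TwoForest {r} r<K =
    missing-cycle-edge⇒IsForest _ (inj₂ refl) K∉S ,
    cut⇒¬Connected _ r<K r∉S (⊥-elim ∘ K∉S) ,
    cover
    where
    K∉S : ¬ omit {K + 1} r K ∋ K
    K∉S = omit-∌ʳ (≤K⇒<K+1 ≤-refl)
    r∉S : ¬ omit {K + 1} r K ∋ r
    r∉S = omit-∌ˡ (≤K⇒<K+1 (<⇒≤ r<K))
    cover : t ≤ K → Connected G (omit r K) (V 0) (V t) ⊎ Connected G (omit r K) (V K) (V t)
    cover {t} t≤K with t ≤? r
    ... | yes t≤r = inj₁ (omit-block (<⇒≤ r<K) (inj₂ ≤-refl) (inj₂ (<⇒≤ r<K))
                                     (z≤n , z≤n) (z≤n , t≤r))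
    ... | no t≰r  = inj₂ (omit-block ≤-refl (inj₁ ≤-refl) (inj₂ ≤-refl)
                                     (r<K , ≤-refl) (≰⇒> t≰r , t≤K))

  -- The kept path edges form the blocks [0, r], [r + 1, s], [s + 1, K] (or the same with r and s
  -- swapped), and the chord attaches the middle block to the first one if b ≤ s, to the last one
  -- if s < a.
  omit-TwoForest : InCycle r → OffCycle s → s < K → TwoForest (omit r s)
  omit-TwoForest {r} {s} (a≤r , r<b) s-off s<K =
    missing-cycle-edge⇒IsForest _ (inj₁ (a≤r , r<b)) r∉S ,
    cut⇒¬Connected _ s<K s∉S (λ _ → s-off) ,
    cover s-off
    where
    open Walks G (omit r s)
    r<K : r < K
    r<K = <-≤-trans r<b b≤K
    r∉S : ¬ omit {K + 1} r s ∋ r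
    r∉S = omit-∌ˡ (≤K⇒<K+1 (<⇒≤ r<K))
    s∉S : ¬ omit {K + 1} r s ∋ s
    s∉S = omit-∌ʳ (≤K⇒<K+1 (<⇒≤ s<K))
    chord : Connected G (omit r s) (V a) (V b)
    chord = chord-connected _
      (Equivalence.from (omit-∋ (≤K⇒<K+1 ≤-refl)) (>⇒≢ r<K , >⇒≢ s<K))
    cover : OffCycle s → t ≤ K →
            Connected G (omit r s) (V 0) (V t) ⊎ Connected G (omit r s) (V K) (V t)
    cover {t} (inj₂ b≤s) t≤K with t ≤? r | t ≤? s
    ... | yes t≤r | _ =
      inj₁ (omit-block (<⇒≤ r<K) (inj₂ ≤-refl) (inj₂ r≤s) (z≤n , z≤n) (z≤n , t≤r))
      where
      r≤s : r ≤ s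
      r≤s = <⇒≤ (<-≤-trans r<b b≤s)
    ... | no t≰r | yes t≤s =
      inj₁ (Connected-trans
        (omit-block (<⇒≤ r<K) (inj₂ ≤-refl) (inj₂ r≤s) (z≤n , z≤n) (z≤n , a≤r))
        (Connected-trans chord
          (omit-block (<⇒≤ s<K) (inj₁ ≤-refl) (inj₂ ≤-refl) (r<b , b≤s) (≰⇒> t≰r , t≤s))))
      where
      r≤s : r ≤ s
      r≤s = <⇒≤ (<-≤-trans r<b b≤s)
    ... | no _ | no t≰s =
      inj₂ (omit-block ≤-refl (inj₁ r<1+s) (inj₁ ≤-refl) (s<K , ≤-refl) (≰⇒> t≰s , t≤K))
      where
      r<1+s : r < suc s
      r<1+s = <-trans (<-≤-trans r<b b≤s) (n<1+n s)
    cover {t} (inj₁ s<a) t≤K with t ≤? s | t ≤? r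
    ... | yes t≤s | _ =
      inj₁ (omit-block (<⇒≤ s<K) (inj₂ s≤r) (inj₂ ≤-refl) (z≤n , z≤n) (z≤n , t≤s))
      where
      s≤r : s ≤ r
      s≤r = <⇒≤ (<-≤-trans s<a a≤r)
    ... | no t≰s | yes t≤r =
      inj₂ (Connected-trans
        (omit-block ≤-refl (inj₁ r<b) (inj₁ (<-trans s<a a<b)) (b≤K , ≤-refl) (≤-refl , b≤K))
        (Connected-trans (Connected-sym chord)
          (omit-block (<⇒≤ r<K) (inj₂ ≤-refl) (inj₁ ≤-refl) (s<a , a≤r) (≰⇒> t≰s , t≤r))))
    ... | no _ | no t≰r =
      inj₂ (omit-block ≤-refl (inj₁ ≤-refl) (inj₁ s<1+r) (r<K , ≤-refl) (≰⇒> t≰r , t≤K))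
      where
      s<1+r : s < suc r
      s<1+r = <-trans (<-≤-trans s<a a≤r) (n<1+n r)

  cycleEdge : Fin d → ℕ
  cycleEdge i = a + toℕ i

  offCycleEdge : Fin a ⊎ Fin e → ℕ
  offCycleEdge (inj₁ j) = toℕ j
  offCycleEdge (inj₂ j) = b + toℕ j

  cycleEdge-InCycle : ∀ i → InCycle (cycleEdge i)
  cycleEdge-InCycle i = m≤m+n a (toℕ i) , +-monoʳ-< a (toℕ<n i)

  cycleEdge<K : ∀ i → cycleEdge i < K
  cycleEdge<K i = <-≤-trans (proj₂ (cycleEdge-InCycle i)) b≤K

  offCycleEdge-OffCycle : ∀ j → OffCycle (offCycleEdge j)
  offCycleEdge-OffCycle (inj₁ j) = inj₁ (toℕ<n j)
  offCycleEdge-OffCycle (inj₂ j) = inj₂ (m≤m+n b (toℕ j))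

  offCycleEdge<K : ∀ j → offCycleEdge j < K
  offCycleEdge<K (inj₁ j) = <-≤-trans (toℕ<n j) a≤K
  offCycleEdge<K (inj₂ j) = +-monoʳ-< b (toℕ<n j)

  cycleEdge-injective : ∀ {i i′} → cycleEdge i ≡ cycleEdge i′ → i ≡ i′
  cycleEdge-injective = toℕ-injective ∘ +-cancelˡ-≡ a _ _

  offCycleEdge-injective : ∀ {j j′} → offCycleEdge j ≡ offCycleEdge j′ → j ≡ j′
  offCycleEdge-injective {inj₁ j} {inj₁ j′} eq = cong inj₁ (toℕ-injective eq)
  offCycleEdge-injective {inj₂ j} {inj₂ j′} eq =
    cong inj₂ (toℕ-injective (+-cancelˡ-≡ b _ _ eq))
  offCycleEdge-injective {inj₁ j} {inj₂ j′} eq =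
    ⊥-elim (<⇒≱ (<-≤-trans (toℕ<n j) (<⇒≤ a<b)) (subst (b ≤_) (sym eq) (m≤m+n b _)))
  offCycleEdge-injective {inj₂ j} {inj₁ j′} eq =
    ⊥-elim (<⇒≱ (<-≤-trans (toℕ<n j′) (<⇒≤ a<b)) (subst (b ≤_) eq (m≤m+n b _)))

  cycleEdge-surjective : InCycle r → ∃ λ i → cycleEdge i ≡ r
  cycleEdge-surjective (a≤r , r<b) =
    fromℕ< (subst (_ <_) (m+n∸m≡n a d) (∸-monoˡ-< r<b a≤r)) ,
    trans (cong (a +_) (toℕ-fromℕ< _)) (m+[n∸m]≡n a≤r)

  offCycleEdge-surjective : OffCycle s → s < K → ∃ λ j → offCycleEdge j ≡ s
  offCycleEdge-surjective (inj₁ s<a) _   = inj₁ (fromℕ< s<a) , toℕ-fromℕ< s<a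
  offCycleEdge-surjective (inj₂ b≤s) s<K =
    inj₂ (fromℕ< (subst (_ <_) (m+n∸m≡n b e) (∸-monoˡ-< s<K b≤s))) ,
    trans (cong (b +_) (toℕ-fromℕ< _)) (m+[n∸m]≡n b≤s)

  Code : Set
  Code = Fin K ⊎ (Fin d × (Fin a ⊎ Fin e))

  Fin↔Code : Fin (K + d * (a + e)) ↔ Code
  Fin↔Code = ↔-trans +↔⊎ (↔-refl ⊎-↔ ↔-trans *↔× (↔-refl ×-↔ +↔⊎))

  decode : Code → EdgeSet G
  decode (inj₁ r)       = omit (toℕ r) K
  decode (inj₂ (i , j)) = omit (cycleEdge i) (offCycleEdge j)

  chordless≢decode : ∀ {r} i j → omit r K ≢ decode (inj₂ (i , j))
  chordless≢decode i j eq = omit-∌ʳ K<K+1 (subst (_∋ K) (sym eq)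
    (Equivalence.from (omit-∋ K<K+1) (>⇒≢ (cycleEdge<K i) , >⇒≢ (offCycleEdge<K j))))
    where
    K<K+1 : K < K + 1
    K<K+1 = ≤K⇒<K+1 ≤-refl

  decode-injective : ∀ {c c′} → decode c ≡ decode c′ → c ≡ c′
  decode-injective {inj₁ r} {inj₁ r′} eq = cong inj₁ (toℕ-injective (proj₁
    (omit-injective (≤K⇒<K+1 (<⇒≤ (toℕ<n r))) (≤K⇒<K+1 ≤-refl)
                    (<⇒≢ (toℕ<n r)) (>⇒≢ (toℕ<n r′)) eq)))
  decode-injective {inj₁ _} {inj₂ (i , j)} eq = ⊥-elim (chordless≢decode i j eq)
  decode-injective {inj₂ (i , j)} {inj₁ _} eq = ⊥-elim (chordless≢decode i j (sym eq))
  decode-injective {inj₂ (i , j)} {inj₂ (i′ , j′)} eq =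
    let (i↦i′ , j↦j′) =
          omit-injective (≤K⇒<K+1 (<⇒≤ (cycleEdge<K i))) (≤K⇒<K+1 (<⇒≤ (offCycleEdge<K j)))
            (Between⇒≢Outside (cycleEdge-InCycle i) (offCycleEdge-OffCycle j′))
            (≢-sym (Between⇒≢Outside (cycleEdge-InCycle i′) (offCycleEdge-OffCycle j)))
            eq
    in cong inj₂ (cong₂ _,_ (cycleEdge-injective i↦i′) (offCycleEdge-injective j↦j′))

  decode-TwoForest : ∀ c → TwoForest (decode c)
  decode-TwoForest (inj₁ r)       = omit-chord-TwoForest (toℕ<n r)
  decode-TwoForest (inj₂ (i , j)) =
    omit-TwoForest (cycleEdge-InCycle i) (offCycleEdge-OffCycle j) (offCycleEdge<K j)

  TwoForest⇒decode : ∀ S → TwoForest S → ∃ λ c → decode c ≡ S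
  TwoForest⇒decode S twoForest with T? (at S K)
  ... | no K∉S =
    let (r , r<K , S≡) = TwoForest-without-chord S twoForest K∉S
    in inj₁ (fromℕ< r<K) , trans (cong (λ r → omit r K) (toℕ-fromℕ< r<K)) (sym S≡)
  ... | yes K∈S =
    let (r , s , r-in , s-off , s<K , S≡) = TwoForest-with-chord S twoForest K∈S
        (i , i↦r) = cycleEdge-surjective r-in
        (j , j↦s) = offCycleEdge-surjective s-off s<K
    in inj₂ (i , j) , trans (cong₂ omit i↦r j↦s) (sym S≡)

  F₂≡-count : F₂≡ G zero (fromℕ K) (K + d * (a + e))
  F₂≡-count = F₂≡-fromEncoding Fin↔Code decode decode-injective λ S → mk⇔
    (TwoForest⇒decode S ∘ Equivalence.to (IsTwoForest⇔TwoForest S))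
    (λ (c , c↦S) → Equivalence.from (IsTwoForest⇔TwoForest S)
                     (subst TwoForest c↦S (decode-TwoForest c)))

k+n∸m≡ : ∀ a d e → suc (a + d + e) + suc a ∸ (suc a + d) ≡ suc (a + e)
k+n∸m≡ a d e = begin
  a + d + e + suc a ∸ (a + d)    ≡⟨ cong (_∸ (a + d)) (+-assoc (a + d) e (suc a)) ⟩
  a + d + (e + suc a) ∸ (a + d)  ≡⟨ m+n∸m≡n (a + d) (e + suc a) ⟩
  e + suc a                      ≡⟨ +-suc e a ⟩
  suc (e + a)                    ≡⟨ cong suc (+-comm e a) ⟩
  suc (a + e)                    ∎
  where open ≡-Reasoning

count≡first-form : ∀ a d e → a + d + e + d * (a + e) ≡
  (suc a + d ∸ suc a) * (suc (a + d + e) + suc a ∸ (suc a + d)) +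
  (suc (a + d + e) + suc a ∸ (suc a + d) ∸ 1)
count≡first-form a d e rewrite m+n∸m≡n (suc a) d | k+n∸m≡ a d e = identity a d e
  where
  identity : ∀ a d e → a + d + e + d * (a + e) ≡ d * suc (a + e) + (a + e)
  identity = solve-∀

count≡second-form : ∀ a d e → a + d + e + d * (a + e) ≡
  (suc (a + d + e) + suc a ∸ (suc a + d)) * (suc a + d ∸ suc a + 1) ∸ 1
count≡second-form a d e rewrite m+n∸m≡n (suc a) d | k+n∸m≡ a d e | +-comm d 1 = identity a d e
  where
  identity : ∀ a d e → a + d + e + d * (a + e) ≡ d + (a + e) * suc d
  identity = solve-∀

lemma7p3 : (K n m : ℕ) → 4 ≤ suc K → 2 ≤ n → n + 2 ≤ suc K → n + 2 ≤ m → m ≤ suc K →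
    F₂≡ (L K n m) zero (fromℕ K) ((m ∸ n) * (suc K + n ∸ m) + (suc K + n ∸ m ∸ 1))
    × F₂≡ (L K n m) zero (fromℕ K) ((suc K + n ∸ m) * (m ∸ n + 1) ∸ 1)
-- The bounds 4 ≤ k and n + 2 ≤ k follow from the others.
lemma7p3 K n m _ 2≤n _ n+2≤m m≤k
  with a , refl ← m≤n⇒∃[o]m+o≡n (m+n≤o⇒m≤o 1 2≤n)
  with d , refl ← m≤n⇒∃[o]m+o≡n (m+n≤o⇒m≤o n n+2≤m)
  with e , refl ← m≤n⇒∃[o]m+o≡n m≤k =
  subst (F₂≡ _ _ _) (count≡first-form a d e) count ,
  subst (F₂≡ _ _ _) (count≡second-form a d e) count
  where
  count : F₂≡ (L (a + d + e) (suc a) (suc (a + d))) zero (fromℕ (a + d + e))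
              (a + d + e + d * (a + e))
  count = PathWithChord.F₂≡-count a d e (m+n≤o⇒m≤o 1 (+-cancelˡ-≤ (suc a) 2 d n+2≤m))
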